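{- Let $a,b\in\mathbf{V}$, let $f:a\to b$ be a function in $\mathbf{V}$, and let $\hat f=\{(\mathrm{op}(\mathfrak{r}(c),\mathfrak{r}(f(c))),\pi):c\in a,\ \pi\in\Pi\}$. Then for every $c\in a$: $\mathsf{I}\Vdash\forall z\,(\mathrm{op}(\mathfrak{r}(c),z)\,\varepsilon\,\hat f\to\mathfrak{r}(f(c))=z)$ and $\mathsf{I}\Vdash\forall z\,(\mathfrak{r}(f(c))=z\hookrightarrow\mathrm{op}(\mathfrak{r}(c),z)\,\varepsilon\,\hat f)$, where $\mathsf{I}=\lambda u.u$.
   Context: Setting (Krivine realizability) over a model $\mathbf{V}$ of ZF with realizability algebra $(\Lambda,\Pi,\succ,\perp\!\!\!\perp)$: $\Lambda$ closed $\lambda_c$-terms (variables, application, abstraction, $\mathsf{cc}$, continuation constants $\mathsf{k}_\pi$, possibly special instructions), $\Pi$ stacks (stack bottoms and $t\cdot\pi$), $\succ$ a preorder on processes containing $ts\star\pi\succ t\star s\cdot\pi$, $\lambda u.t\star s\cdot\pi\succ t[u:=s]\star\pi$, $\mathsf{cc}\star t\cdot\pi\succ t\star\mathsf{k}_\pi\cdot\pi$, $\mathsf{k}_\sigma\star t\cdot\pi\succ t\star\sigma$; pole $\perp\!\!\!\perp$ closed under anti-reduction. Church numerals $\underline0=\lambda u.\lambda v.v$, $\underline1=\lambda u.\lambda v.uv$. Names $\mathbf{N}=\bigcup_\alpha\mathbf{N}_\alpha$, $\mathbf{N}_\alpha=\bigcup_{\beta<\alpha}\mathcal{P}(\mathbf{N}_\beta\times\Pi)$.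 Falsity values of closed formulas with parameters in $\mathbf{N}$: $\|\perp\|=\Pi$, $\|a\not\varepsilon b\|=\{\pi:(a,\pi)\in b\}$, $\|a\neq b\|=\Pi$ if $a,b$ are the same set and $\emptyset$ otherwise, $\|a=b\hookrightarrow\varphi\|=\|\varphi\|$ if $a,b$ are the same set and $\emptyset$ otherwise, $\|\varphi\to\psi\|=\{t\cdot\pi:t\Vdash\varphi,\pi\in\|\psi\|\}$, $\|\forall x\varphi\|=\bigcup_{a\in\mathbf{N}}\|\varphi(a)\|$; $t\Vdash\varphi$ iff $t\star\pi\in\perp\!\!\!\perp$ for all $\pi\in\|\varphi\|$. Abbreviations: $a\,\varepsilon\,b:=a\not\varepsilon b\to\perp$, $a=b:=a\neq b\to\perp$. Reish: $\mathfrak{r}(x)=\{(\mathfrak{r}(y),\pi):y\in x,\pi\in\Pi\}$. Operations: $\mathrm{sng}(a)=\{a\}\times\Pi$; $\mathrm{up}(a,b)=\{(a,\underline0\cdot\pi):\pi\in\Pi\}\cup\{(b,\underline1\cdot\pi):\pi\in\Pi\}$; $\mathrm{op}(a,b)=\mathrm{up}(\mathrm{up}(\mathrm{sng}(a),\mathfrak{r}(0)),\mathrm{sng}(\mathrm{sng}(b)))$; these may occur in formulas and are evaluated on parameters in $\mathbf{V}$. -}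

module Defs where

import Level
open import Level using (Lift; lift)
open import Data.Nat using (ℕ; zero; suc)
open import Data.Fin using (Fin; zero; suc)
open import Data.Bool using (Bool; true; false; if_then_else_)
open import Data.Empty using (⊥)
open import Data.Unit using (⊤)
open import Data.Product using (Σ; ∃; _×_; _,_; proj₁; proj₂)
open import Relation.Binary.PropositionalEquality using (_≡_)

-- The ground model V: well-founded (Aczel-style) sets, equality is
-- extensional equality (bisimulation), membership is up to it.

data V : Set₁ where
  sup : (A : Set) → (A → V) → V

_≐_ : V → V → Set
sup A f ≐ sup B g = (∀ i → ∃ λ j → f i ≐ g j) × (∀ j → ∃ λ i → f i ≐ g j)

_∈ᵥ_ : V → V → Set
x ∈ᵥ sup A f = ∃ λ i → x ≐ f i

emptyᵥ : V
emptyᵥ = sup ⊥ (λ ())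

-- Syntax of the λc-calculus: terms (de Bruijn, indexed by scope),
-- with cc, continuation constants k_π and special instructions (Ins);
-- stacks are stack bottoms (Bot) or t · π with t closed.

module Core (Ins Bot : Set) where

  mutual
    data Tm : ℕ → Set where
      var : ∀ {n} → Fin n → Tm n
      app : ∀ {n} → Tm n → Tm n → Tm n
      lam : ∀ {n} → Tm (suc n) → Tm n
      cc  : ∀ {n} → Tm n
      kk  : ∀ {n} → Stk → Tm n
      ins : ∀ {n} → Ins → Tm n

    data Stk : Set where
      bot : Bot → Stk
      _·_ : Tm 0 → Stk → Stk

  infixr 5 _·_

  Λ : Set
  Λ = Tm 0

  Proc : Set
  Proc = Λ × Stk

  ext : ∀ {m n} → (Fin m → Fin n) → Fin (suc m) → Fin (suc n)
  ext ρ zero = zero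
  ext ρ (suc i) = suc (ρ i)

  rename : ∀ {m n} → (Fin m → Fin n) → Tm m → Tm n
  rename ρ (var i) = var (ρ i)
  rename ρ (app t u) = app (rename ρ t) (rename ρ u)
  rename ρ (lam t) = lam (rename (ext ρ) t)
  rename ρ cc = cc
  rename ρ (kk π) = kk π
  rename ρ (ins x) = ins x

  exts : ∀ {m n} → (Fin m → Tm n) → Fin (suc m) → Tm (suc n)
  exts σ zero = var zero
  exts σ (suc i) = rename suc (σ i)

  subst : ∀ {m n} → (Fin m → Tm n) → Tm m → Tm n
  subst σ (var i) = σ i
  subst σ (app t u) = app (subst σ t) (subst σ u)
  subst σ (lam t) = lam (subst (exts σ) t)
  subst σ cc = cc
  subst σ (kk π) = kk π
  subst σ (ins x) = ins x

  _[0:=_] : Tm 1 → Λ → Λ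
  t [0:= s ] = subst (λ { zero → s ; (suc ()) }) t

  c0 : Λ
  c0 = lam (lam (var zero))

  c1 : Λ
  c1 = lam (lam (app (var (suc zero)) (var zero)))

  I : Λ
  I = lam (var zero)

  record RA : Set₁ where
    field
      _≻_ : Proc → Proc → Set
      ≻-refl  : ∀ p → p ≻ p
      ≻-trans : ∀ {p q r} → p ≻ q → q ≻ r → p ≻ r
      push    : ∀ t s π → (app t s , π) ≻ (t , s · π)
      grab    : ∀ t s π → (lam t , s · π) ≻ (t [0:= s ] , π)
      save    : ∀ t π → (cc , t · π) ≻ (t , kk π · π)
      restore : ∀ σ t π → (kk σ , t · π) ≻ (t , σ)
      pole    : Proc → Set
      anti    : ∀ {p q} → p ≻ q → pole q → pole p

  -- Names: a name is a set of pairs (name, stack), i.e. an element of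
  -- some P(N_β × Π); presented as an indexed family.

  data Name : Set₁ where
    mk : (A : Set) → (A → Name) → (A → Stk) → Name

  _≈_ : Name → Name → Set
  mk A f s ≈ mk B g t =
    (∀ i → ∃ λ j → (f i ≈ g j) × (s i ≡ t j)) ×
    (∀ j → ∃ λ i → (f i ≈ g j) × (s i ≡ t j))

  _,_∈ₙ_ : Name → Stk → Name → Set
  a , π ∈ₙ mk A f s = ∃ λ i → (a ≈ f i) × (π ≡ s i)

  𝔯 : V → Name
  𝔯 (sup A f) = mk (A × Stk) (λ p → 𝔯 (f (proj₁ p))) proj₂

  sng : Name → Name
  sng a = mk Stk (λ _ → a) (λ π → π)

  up : Name → Name → Name
  up a b = mk (Bool × Stk)
              (λ p → if proj₁ p then b else a)
              (λ p → if proj₁ p then c1 · proj₂ p else c0 · proj₂ p)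

  op : Name → Name → Name
  op a b = up (up (sng a) (𝔯 emptyᵥ)) (sng (sng b))

  fhat : V → (V → V) → Name
  fhat (sup A g) F =
    mk (A × Stk) (λ p → op (𝔯 (g (proj₁ p))) (𝔯 (F (g (proj₁ p))))) proj₂

module Realizability {Ins Bot : Set} (R : Core.RA Ins Bot) where
  open Core Ins Bot
  open RA R

  FV : Set₂
  FV = Stk → Set₁

  _⊩_ : Λ → FV → Set₁
  t ⊩ φ = ∀ π → φ π → pole (t , π)

  ‖⊥‖ : FV
  ‖⊥‖ _ = Lift (Level.suc Level.zero) ⊤

  _∉_ : Name → Name → FV
  (a ∉ b) π = Lift (Level.suc Level.zero) (a , π ∈ₙ b)

  _≠_ : Name → Name → FV
  (a ≠ b) π = Lift (Level.suc Level.zero) (a ≈ b)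

  _==_↪_ : Name → Name → FV → FV
  (a == b ↪ φ) π = Lift (Level.suc Level.zero) (a ≈ b) × φ π

  _⇒_ : FV → FV → FV
  (φ ⇒ ψ) π = Σ Λ λ t → Σ Stk λ ρ → (π ≡ t · ρ) × (t ⊩ φ) × ψ ρ

  Forall : (Name → FV) → FV
  Forall φ π = Σ Name λ a → φ a π

  _ε_ : Name → Name → FV
  a ε b = (a ∉ b) ⇒ ‖⊥‖

  _=ₙ_ : Name → Name → FV
  a =ₙ b = (a ≠ b) ⇒ ‖⊥‖

  infixr 4 _⇒_
  infix 6 _ε_ _=ₙ_ _∉_ _≠_

{-# OPTIONS --safe #-}
-- The names 𝔯 c, sng, up and op are injective up to "same set" (each needs a
-- stack to probe with, since every element of a name is paired with stacks),
-- so op (𝔯 c) z ∈ f̂ forces 𝔯 (f c) ≈ z.  Both claims then come from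
-- I ⊩ φ ⇒ ψ whenever ‖ψ‖ ⊆ ‖φ‖: first because this functionality makes every
-- realizer of 𝔯 (f c) ≠ z realize op (𝔯 c) z ∉ f̂, second because 𝔯 (f c) ≈ z
-- puts every stack into ‖op (𝔯 c) z ∉ f̂‖.
module Submission where

open import Defs
open import Data.Product using (_×_; _,_; proj₁; proj₂)
open import Data.Bool using (true; false)
open import Data.Fin using (zero)
open import Level using (lift)
open import Relation.Binary.PropositionalEquality using (refl; sym; trans)

module Names (Ins Bot : Set) where
  open Core Ins Bot

  ≈-refl : ∀ a → a ≈ a
  ≈-refl (mk A f s) =
    (λ i → i , ≈-refl (f i) , refl) , (λ i → i , ≈-refl (f i) , refl)

  ≈-sym : ∀ a b → a ≈ b → b ≈ a
  ≈-sym (mk A f s) (mk B g t) (p , q) =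
    (λ j → let (i , e , st) = q j in i , ≈-sym (f i) (g j) e , sym st) ,
    (λ i → let (j , e , st) = p i in j , ≈-sym (f i) (g j) e , sym st)

  ≈-trans : ∀ a b c → a ≈ b → b ≈ c → a ≈ c
  ≈-trans (mk A f s) (mk B g t) (mk C h u) (p , q) (p' , q') =
    (λ i → let (j , e , st) = p i ; (k , e' , st') = p' j
           in k , ≈-trans (f i) (g j) (h k) e e' , trans st st') ,
    (λ k → let (j , e' , st') = q' k ; (i , e , st) = q j
           in i , ≈-trans (f i) (g j) (h k) e e' , trans st st')

  𝔯-cong : ∀ x y → x ≐ y → 𝔯 x ≈ 𝔯 y
  𝔯-cong (sup A f) (sup B g) (p , q) =
    (λ { (i , π) → let (j , e) = p i in (j , π) , 𝔯-cong (f i) (g j) e , refl }) ,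
    (λ { (j , π) → let (i , e) = q j in (i , π) , 𝔯-cong (f i) (g j) e , refl })

  𝔯-injective : Stk → ∀ x y → 𝔯 x ≈ 𝔯 y → x ≐ y
  𝔯-injective π (sup A f) (sup B g) (p , q) =
    (λ i → let ((j , _) , e , _) = p (i , π) in j , 𝔯-injective π (f i) (g j) e) ,
    (λ j → let ((i , _) , e , _) = q (j , π) in i , 𝔯-injective π (f i) (g j) e)

  sng-cong : ∀ a b → a ≈ b → sng a ≈ sng b
  sng-cong a b e = (λ π → π , e , refl) , (λ π → π , e , refl)

  sng-injective : Stk → ∀ a b → sng a ≈ sng b → a ≈ b
  sng-injective π a b (p , _) = proj₁ (proj₂ (p π))

  up-cong : ∀ a b a' b' → a ≈ a' → b ≈ b' → up a b ≈ up a' b'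
  up-cong a b a' b' e e' =
    (λ { (false , π) → (false , π) , e , refl ; (true , π) → (true , π) , e' , refl }) ,
    (λ { (false , π) → (false , π) , e , refl ; (true , π) → (true , π) , e' , refl })

  -- The tags c0 and c1 on the stacks keep the two components apart.
  up-injectiveˡ : Stk → ∀ a b a' b' → up a b ≈ up a' b' → a ≈ a'
  up-injectiveˡ π a b a' b' (p , _) with p (false , π)
  ... | (false , _) , e , _ = e
  ... | (true , _) , _ , ()

  up-injectiveʳ : Stk → ∀ a b a' b' → up a b ≈ up a' b' → b ≈ b'
  up-injectiveʳ π a b a' b' (p , _) with p (true , π)
  ... | (true , _) , e , _ = e
  ... | (false , _) , _ , ()

  op-cong : ∀ a b a' b' → a ≈ a' → b ≈ b' → op a b ≈ op a' b'
  op-cong a b a' b' e e' =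
    up-cong _ _ _ _ (up-cong _ _ _ _ (sng-cong _ _ e) (≈-refl _))
      (sng-cong _ _ (sng-cong _ _ e'))

  op-injective : Stk → ∀ a b a' b' → op a b ≈ op a' b' → a ≈ a' × b ≈ b'
  op-injective π a b a' b' e =
    sng-injective π _ _ (up-injectiveˡ π _ _ _ _ (up-injectiveˡ π _ _ _ _ e)) ,
    sng-injective π _ _ (sng-injective π _ _ (up-injectiveʳ π _ _ _ _ e))

  module Graph (f : V → V) (f-ext : ∀ x y → x ≐ y → f x ≐ f y) where

    fhat-functional : ∀ a c z π → op (𝔯 c) z , π ∈ₙ fhat a f → 𝔯 (f c) ≈ z
    fhat-functional (sup A g) c z π ((i , _) , e , _) =
      ≈-trans _ _ _ (𝔯-cong _ _ (f-ext _ _ (𝔯-injective π _ _ c≈gi)))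
                    (≈-sym _ _ z≈fgi)
      where
      c≈gi = proj₁ (op-injective π _ _ _ _ e)
      z≈fgi = proj₂ (op-injective π _ _ _ _ e)

    fhat-total : ∀ a c z π → c ∈ᵥ a → 𝔯 (f c) ≈ z → op (𝔯 c) z , π ∈ₙ fhat a f
    fhat-total (sup A g) c z π (i , c≐gi) fc≈z =
      (i , π) ,
      op-cong _ _ _ _ (𝔯-cong _ _ c≐gi)
        (≈-trans _ _ _ (≈-sym _ _ fc≈z) (𝔯-cong _ _ (f-ext _ _ c≐gi))) ,
      refl

module Realizers {Ins Bot : Set} (R : Core.RA Ins Bot) where
  open Core Ins Bot
  open RA R
  open Realizability R

  _⊆_ : FV → FV → Set₁
  φ ⊆ ψ = ∀ π → φ π → ψ π

  ⊩-antitone : ∀ {t φ ψ} → φ ⊆ ψ → t ⊩ ψ → t ⊩ φ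
  ⊩-antitone φ⊆ψ t⊩ψ π π∈φ = t⊩ψ π (φ⊆ψ π π∈φ)

  ⇒-antitone : ∀ {φ φ' ψ} → φ ⊆ φ' → (φ' ⇒ ψ) ⊆ (φ ⇒ ψ)
  ⇒-antitone φ⊆φ' _ (t , ρ , π≡ , t⊩φ' , ρ∈ψ) =
    t , ρ , π≡ , ⊩-antitone φ⊆φ' t⊩φ' , ρ∈ψ

  I-⊩-⇒ : ∀ {φ ψ} → ψ ⊆ φ → I ⊩ (φ ⇒ ψ)
  I-⊩-⇒ ψ⊆φ _ (t , ρ , refl , t⊩φ , ρ∈ψ) =
    anti (grab (var zero) t ρ) (t⊩φ ρ (ψ⊆φ ρ ρ∈ψ))

  ⊩-Forall : ∀ {t φ} → (∀ a → t ⊩ φ a) → t ⊩ Forall φ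
  ⊩-Forall t⊩φ π (a , π∈φa) = t⊩φ a π π∈φa

  ⊩-↪ : ∀ {t a b φ} → (a ≈ b → t ⊩ φ) → t ⊩ (a == b ↪ φ)
  ⊩-↪ t⊩φ π (lift a≈b , π∈φ) = t⊩φ a≈b π π∈φ

proposition16p2 :
  (Ins Bot : Set) (R : Core.RA Ins Bot) →
  let open Core Ins Bot
      open Realizability R
  in (a b : V) (f : V → V) →
     (∀ x y → x ≐ y → f x ≐ f y) →
     (∀ x → x ∈ᵥ a → f x ∈ᵥ b) →
     ∀ c → c ∈ᵥ a →
     (I ⊩ Forall (λ z → (op (𝔯 c) z ε fhat a f) ⇒ (𝔯 (f c) =ₙ z)))
     × (I ⊩ Forall (λ z → 𝔯 (f c) == z ↪ (op (𝔯 c) z ε fhat a f)))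
proposition16p2 Ins Bot R a _ f f-ext _ c c∈a =
  ⊩-Forall (λ z → I-⊩-⇒ (⇒-antitone (λ π (lift m) →
    lift (fhat-functional a c z π m)))) ,
  ⊩-Forall (λ z → ⊩-↪ (λ fc≈z → I-⊩-⇒ (λ π _ →
    lift (fhat-total a c z π c∈a fc≈z))))
  where
  open Realizability R
  open Realizers R
  open Names.Graph Ins Bot f f-ext
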